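{- Let $\mathbb{A}$ be an infinite alphabet of independent indeterminates, and let $\mathbb{A}^0=\mathbb{A},\mathbb{A}^1,\mathbb{A}^2,\dots$ be the formal alphabets such that $\sigma_z(\mathbb{A}^0)=\sigma_z(\mathbb{A})$ and $\sigma_z(\mathbb{A}^k)$, $k\ge1$, are the successive remainders of the Euclidean division (as defined in the context) of $1$ by $\sigma_z(\mathbb{A})$. Then $$ \frac1z\,\sigma_{1/z}(\mathbb{A})=\cfrac{1}{z+S_1(0-\mathbb{A}^0)+\cfrac{S_2(0-\mathbb{A}^0)}{z+S_1(\mathbb{A}^0-\mathbb{A}^1)+\cfrac{S_2(\mathbb{A}^0-\mathbb{A}^1)}{z+S_1(\mathbb{A}^1-\mathbb{A}^2)+\cfrac{S_2(\mathbb{A}^1-\mathbb{A}^2)}{\ddots}}}} $$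
   Context: For an alphabet $\mathbb{A}$, $\sigma_z(\mathbb{A}):=\prod_{a\in\mathbb{A}}(1-za)^{ -1}=\sum_{i\ge0}z^iS_i(\mathbb{A})$; any unitary series $1+c_1z+\cdots$ is formally written $\sigma_z(\mathbb{C})$ for a formal alphabet $\mathbb{C}$. For formal alphabets, $\sigma_z(\mathbb{C}-\mathbb{D}):=\sigma_z(\mathbb{C})/\sigma_z(\mathbb{D})=\sum_{i\ge0}z^iS_i(\mathbb{C}-\mathbb{D})$; in particular $S_i(0-\mathbb{A}^0)$ are the coefficients of $1/\sigma_z(\mathbb{A})$ and $S_i(\mathbb{A}^{k-1}-\mathbb{A}^k)$ those of $\sigma_z(\mathbb{A}^{k-1})/\sigma_z(\mathbb{A}^k)$. $\sigma_{1/z}$ means the same series with $z$ replaced by $1/z$. Coefficients lie in the field of fractions of the ring generated by the $S_i(\mathbb{A})$. Euclidean division of series: given unitary series $f_{ -1},f_0$, one defines recursively for $k\ge0$ the unitary series $f_{k+1}$ and scalars $\alpha_k,\beta_k$ ($\beta_k\neq0$) as the unique ones with $f_{k-1}(z)=(1+\alpha_kz)f_k(z)+\beta_kz^2f_{k+1}(z)$; here $f_{ -1}=1$, $f_0=\sigma_z(\mathbb{A})$, $f_k=\sigma_z(\mathbb{A}^k)$. The infinite continued fraction is an identity of formal Laurent series in $z^{ -1}$, understood as the limit (in the $z^{ -1}$-adic topology) of its finite truncations. -}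

module Defs where

open import Level using (Level; _⊔_)
open import Data.Nat using (ℕ; zero; suc; _∸_)
open import Data.Fin using (Fin; toℕ)
import Data.Fin as F
open import Data.Vec using (Vec; []; _∷ʳ_; lookup)
open import Data.Product using (∃)
open import Relation.Nullary using (¬_)
open import Algebra.Bundles using (CommutativeRing)

record IsField {c ℓ : Level} (R : CommutativeRing c ℓ) : Set (c ⊔ ℓ) where
  open CommutativeRing R
  field
    1≉0     : ¬ (1# ≈ 0#)
    inverse : ∀ x → ¬ (x ≈ 0#) → ∃ λ y → x * y ≈ 1#

module Series {c ℓ : Level} (R : CommutativeRing c ℓ) where
  open CommutativeRing R

  Series : Set c
  Series = ℕ → Carrier

  _≈ₛ_ : Series → Series → Set ℓ
  f ≈ₛ g = ∀ n → f n ≈ g n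

  sumF : (n : ℕ) → (Fin n → Carrier) → Carrier
  sumF zero    h = 0#
  sumF (suc n) h = h F.zero + sumF n (λ i → h (F.suc i))

  const : Carrier → Series
  const a zero    = a
  const a (suc n) = 0#

  oneₛ : Series
  oneₛ = const 1#

  zeroₛ : Series
  zeroₛ _ = 0#

  Xₛ : Series
  Xₛ zero          = 0#
  Xₛ (suc zero)    = 1#
  Xₛ (suc (suc n)) = 0#

  _+ₛ_ : Series → Series → Series
  (f +ₛ g) n = f n + g n

  _·ₛ_ : Carrier → Series → Series
  (a ·ₛ f) n = a * f n

  _*ₛ_ : Series → Series → Series
  (f *ₛ g) n = sumF (suc n) (λ i → f (toℕ i) * g (n ∸ toℕ i))

  -- first n coefficients of the multiplicative inverse of a series with
  -- constant term 1 (the constant term of the argument is taken to be 1):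
  -- g 0 = 1,  g n = - Σ_{j<n} f (n - j) * g j
  invVec : Series → (n : ℕ) → Vec Carrier n
  invVec f zero = []
  invVec f (suc zero) = [] ∷ʳ 1#
  invVec f (suc (suc n)) =
    let v = invVec f (suc n)
    in v ∷ʳ (- sumF (suc n) (λ j → f (suc n ∸ toℕ j) * lookup v j))

  invₛ : Series → Series
  invₛ f n = lookup (invVec f (suc n)) (F.fromℕ n)

  -- quotient c / d of unitary series; S_i(C - D) = (σ(C)/σ(D)) coefficient i
  _/ₛ_ : Series → Series → Series
  c /ₛ d = c *ₛ invₛ d

  Unitary : Series → Set ℓ
  Unitary f = f 0 ≈ 1#

  -- Truncations of the continued fraction, written in w = 1/z:
  --   1/(z + a_j + b_j T) = w / (1 + a_j w + b_j w T).
  -- cfTrunc a b j n is the depth-n truncation starting at level j: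
  --   cfTrunc a b j 0 = 0 (tail dropped),
  --   cfTrunc a b j (n+1) = 1/(z + a_j + b_j · cfTrunc a b (j+1) n).
  cfTrunc : (ℕ → Carrier) → (ℕ → Carrier) → ℕ → ℕ → Series
  cfTrunc a b j zero    = zeroₛ
  cfTrunc a b j (suc n) =
    Xₛ *ₛ invₛ (oneₛ +ₛ ((a j ·ₛ Xₛ) +ₛ (b j ·ₛ (Xₛ *ₛ cfTrunc a b (suc j) n))))

{-# OPTIONS --safe #-}
-- Write Tₖⁿ = cfTrunc a b k n, a series in w = Xₛ = 1/z, and read the recurrence
-- f k = (1 + α k w) f (k+1) + β k w² f (k+2) modulo w³: since the unitary
-- series f (k+2) and f (k+1) agree modulo w, f k / f (k+1) ≡ 1 + α k w + β k w²,
-- so the partial quotients a k, b k of the statement are exactly α k, β k.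
-- Then Tₖⁿ f k ≡ w f (k+1) modulo wⁿ⁺¹, by induction on n: Tₖⁿ⁺¹ = w / D with
-- D = 1 + a k w + b k w Tₖ₊₁ⁿ, and by the induction hypothesis
-- D f (k+1) ≡ f (k+1) + α k w f (k+1) + β k w² f (k+2) = f k modulo wⁿ⁺¹.
-- At k = 0, where f 0 = 1, this says T₀ⁿ ≡ w f 1 modulo wⁿ⁺¹.
module Submission where

open import Defs
open import Level using (Level)
open import Data.Nat using (ℕ; zero; suc; _≤_; _<_; _∸_; z≤n; s≤s; s≤s⁻¹)
open import Data.Nat.Properties using (+-∸-assoc; ≤-trans; n≤1+n; <-≤-trans; m∸n≤m)
open import Data.Fin using (Fin; toℕ; fromℕ; inject₁)
import Data.Fin as F
open import Data.Fin.Properties using (toℕ<n; toℕ-fromℕ; toℕ-inject₁)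
open import Data.Fin.Relation.Unary.Top using (view; ‵fromℕ; ‵inj₁)
open import Data.Vec using (Vec; []; _∷_; _∷ʳ_; lookup)
open import Data.Product using (∃; _,_)
open import Relation.Binary.Bundles using (Setoid)
open import Relation.Binary.PropositionalEquality as ≡ using (_≡_)
import Relation.Binary.Reasoning.Setoid as SetoidReasoning
open import Algebra.Bundles using (CommutativeRing)
open import Relation.Nullary using (¬_)

lookup-∷ʳ-fromℕ : ∀ {a} {A : Set a} {n} (v : Vec A n) x → lookup (v ∷ʳ x) (fromℕ n) ≡ x
lookup-∷ʳ-fromℕ []      x = ≡.refl
lookup-∷ʳ-fromℕ (y ∷ v) x = lookup-∷ʳ-fromℕ v x

lookup-∷ʳ-inject₁ : ∀ {a} {A : Set a} {n} (v : Vec A n) x i → lookup (v ∷ʳ x) (inject₁ i) ≡ lookup v i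
lookup-∷ʳ-inject₁ (y ∷ v) x F.zero    = ≡.refl
lookup-∷ʳ-inject₁ (y ∷ v) x (F.suc i) = lookup-∷ʳ-inject₁ v x i

module PowerSeries {c ℓ : Level} (R : CommutativeRing c ℓ) where
  open CommutativeRing R hiding (zero)
  open Series R
  open import Algebra.Properties.CommutativeSemigroup +-commutativeSemigroup
    using (interchange; x∙yz≈y∙xz)
  module ≈-Reasoning = SetoidReasoning setoid

  tail : Series → Series
  tail f n = f (suc n)

  -- Congruence modulo wᵐ; a record rather than a function so that f and g are inferable.
  infix 4 _≈[_]_
  record _≈[_]_ (f : Series) (m : ℕ) (g : Series) : Set ℓ where
    constructor agreeBelow
    field agree : ∀ i → i < m → f i ≈ g i
  open _≈[_]_ public

  ≈[]-setoid : ℕ → Setoid c ℓ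
  ≈[]-setoid m = record
    { Carrier       = Series
    ; _≈_           = _≈[ m ]_
    ; isEquivalence = record
      { refl  = agreeBelow λ _ _ → refl
      ; sym   = λ e → agreeBelow λ i i<m → sym (agree e i i<m)
      ; trans = λ e e′ → agreeBelow λ i i<m → trans (agree e i i<m) (agree e′ i i<m)
      }
    }

  module ≈[]-Reasoning (m : ℕ) = SetoidReasoning (≈[]-setoid m)

  ≈[]-refl : ∀ {m f} → f ≈[ m ] f
  ≈[]-refl {m} = Setoid.refl (≈[]-setoid m)

  ≈[]-sym : ∀ {m f g} → f ≈[ m ] g → g ≈[ m ] f
  ≈[]-sym {m} = Setoid.sym (≈[]-setoid m)

  ≈ₛ⇒≈[] : ∀ {m f g} → f ≈ₛ g → f ≈[ m ] g
  ≈ₛ⇒≈[] e = agreeBelow λ i _ → e i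

  ≈[]-weaken : ∀ {m f g} → f ≈[ suc m ] g → f ≈[ m ] g
  ≈[]-weaken e = agreeBelow λ i i<m → agree e i (≤-trans i<m (n≤1+n _))

  +ₛ-cong-≈[] : ∀ {m f f′ g g′} → f ≈[ m ] f′ → g ≈[ m ] g′ → (f +ₛ g) ≈[ m ] (f′ +ₛ g′)
  +ₛ-cong-≈[] ef eg = agreeBelow λ i i<m → +-cong (agree ef i i<m) (agree eg i i<m)

  ·ₛ-cong-≈[] : ∀ {m x y f g} → x ≈ y → f ≈[ m ] g → (x ·ₛ f) ≈[ m ] (y ·ₛ g)
  ·ₛ-cong-≈[] x≈y e = agreeBelow λ i i<m → *-cong x≈y (agree e i i<m)

  sumF-cong : ∀ n {h h′ : Fin n → Carrier} → (∀ i → h i ≈ h′ i) → sumF n h ≈ sumF n h′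
  sumF-cong zero    e = refl
  sumF-cong (suc n) e = +-cong (e F.zero) (sumF-cong n (λ i → e (F.suc i)))

  -- The i-th coefficient of a product only involves coefficients of index ≤ i.
  *ₛ-cong-≈[] : ∀ {m f f′ g g′} → f ≈[ m ] f′ → g ≈[ m ] g′ → (f *ₛ g) ≈[ m ] (f′ *ₛ g′)
  *ₛ-cong-≈[] ef eg = agreeBelow λ i i<m → sumF-cong (suc i) λ j →
    *-cong (agree ef (toℕ j) (<-≤-trans (toℕ<n j) i<m))
           (agree eg (i ∸ toℕ j) (<-≤-trans (s≤s (m∸n≤m i (toℕ j))) i<m))

  *ₛ-zeroˡ : ∀ g → (zeroₛ *ₛ g) ≈ₛ zeroₛ
  *ₛ-zeroˡ g zero    = trans (+-identityʳ _) (zeroˡ _)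
  *ₛ-zeroˡ g (suc n) = trans (+-cong (zeroˡ _) (*ₛ-zeroˡ g n)) (+-identityʳ _)

  *ₛ-identityˡ : ∀ g → (oneₛ *ₛ g) ≈ₛ g
  *ₛ-identityˡ g zero    = trans (+-identityʳ _) (*-identityˡ _)
  *ₛ-identityˡ g (suc n) = trans (+-cong (*-identityˡ _) (*ₛ-zeroˡ g n)) (+-identityʳ _)

  *ₛ-comm : ∀ f g → (f *ₛ g) ≈ₛ (g *ₛ f)
  *ₛ-comm f g zero    = +-congʳ (*-comm _ _)
  *ₛ-comm f g (suc n) = begin
    f 0 * g (suc n) + (tail f *ₛ g) n  ≈⟨ +-congˡ (*ₛ-comm (tail f) g n) ⟩
    f 0 * g (suc n) + (g *ₛ tail f) n  ≈⟨ swap n ⟩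
    g 0 * f (suc n) + (f *ₛ tail g) n  ≈⟨ +-congˡ (*ₛ-comm f (tail g) n) ⟩
    g 0 * f (suc n) + (tail g *ₛ f) n  ∎
    where
    open ≈-Reasoning
    swap : ∀ n → f 0 * g (suc n) + (g *ₛ tail f) n ≈ g 0 * f (suc n) + (f *ₛ tail g) n
    swap zero = x∙yz≈y∙xz _ _ _
    swap (suc n) = trans (+-congˡ (+-congˡ (*ₛ-comm (tail g) (tail f) n))) (x∙yz≈y∙xz _ _ _)

  *ₛ-identityʳ : ∀ g → (g *ₛ oneₛ) ≈ₛ g
  *ₛ-identityʳ g n = trans (*ₛ-comm g oneₛ n) (*ₛ-identityˡ g n)

  *ₛ-distribʳ : ∀ f g h → ((f +ₛ g) *ₛ h) ≈ₛ ((f *ₛ h) +ₛ (g *ₛ h))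
  *ₛ-distribʳ f g h zero = begin
    (f 0 + g 0) * h 0 + 0#                ≈⟨ +-identityʳ _ ⟩
    (f 0 + g 0) * h 0                     ≈⟨ distribʳ _ _ _ ⟩
    f 0 * h 0 + g 0 * h 0                 ≈⟨ +-cong (+-identityʳ _) (+-identityʳ _) ⟨
    (f 0 * h 0 + 0#) + (g 0 * h 0 + 0#)   ∎
    where open ≈-Reasoning
  *ₛ-distribʳ f g h (suc n) = begin
    (f 0 + g 0) * h (suc n) + ((tail f +ₛ tail g) *ₛ h) n
      ≈⟨ +-cong (distribʳ _ _ _) (*ₛ-distribʳ (tail f) (tail g) h n) ⟩
    (f 0 * h (suc n) + g 0 * h (suc n)) + ((tail f *ₛ h) n + (tail g *ₛ h) n)
      ≈⟨ interchange _ _ _ _ ⟩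
    (f 0 * h (suc n) + (tail f *ₛ h) n) + (g 0 * h (suc n) + (tail g *ₛ h) n) ∎
    where open ≈-Reasoning

  ·ₛ-*ₛ-assoc : ∀ x f g → ((x ·ₛ f) *ₛ g) ≈ₛ (x ·ₛ (f *ₛ g))
  ·ₛ-*ₛ-assoc x f g zero = begin
    (x * f 0) * g 0 + 0#         ≈⟨ +-cong (*-assoc _ _ _) (sym (zeroʳ x)) ⟩
    x * (f 0 * g 0) + x * 0#     ≈⟨ distribˡ _ _ _ ⟨
    x * (f 0 * g 0 + 0#)         ∎
    where open ≈-Reasoning
  ·ₛ-*ₛ-assoc x f g (suc n) = begin
    (x * f 0) * g (suc n) + ((x ·ₛ tail f) *ₛ g) n  ≈⟨ +-cong (*-assoc _ _ _) (·ₛ-*ₛ-assoc x (tail f) g n) ⟩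
    x * (f 0 * g (suc n)) + x * (tail f *ₛ g) n     ≈⟨ distribˡ _ _ _ ⟨
    x * (f 0 * g (suc n) + (tail f *ₛ g) n)         ∎
    where open ≈-Reasoning

  -- tail (f *ₛ g) is f 0 ·ₛ tail g +ₛ tail f *ₛ g, coefficientwise by definition.
  *ₛ-assoc : ∀ f g h → ((f *ₛ g) *ₛ h) ≈ₛ (f *ₛ (g *ₛ h))
  *ₛ-assoc f g h zero = +-congʳ (begin
    (f 0 * g 0 + 0#) * h 0  ≈⟨ *-congʳ (+-identityʳ _) ⟩
    (f 0 * g 0) * h 0       ≈⟨ *-assoc _ _ _ ⟩
    f 0 * (g 0 * h 0)       ≈⟨ *-congˡ (+-identityʳ _) ⟨
    f 0 * (g 0 * h 0 + 0#)  ∎)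
    where open ≈-Reasoning
  *ₛ-assoc f g h (suc n) = begin
    (f *ₛ g) 0 * h (suc n) + (tail (f *ₛ g) *ₛ h) n
      ≈⟨ +-cong (*-congʳ (+-identityʳ _)) (*ₛ-distribʳ (f 0 ·ₛ tail g) (tail f *ₛ g) h n) ⟩
    (f 0 * g 0) * h (suc n) + (((f 0 ·ₛ tail g) *ₛ h) n + ((tail f *ₛ g) *ₛ h) n)
      ≈⟨ +-cong (*-assoc _ _ _) (+-cong (·ₛ-*ₛ-assoc (f 0) (tail g) h n) (*ₛ-assoc (tail f) g h n)) ⟩
    f 0 * (g 0 * h (suc n)) + (f 0 * (tail g *ₛ h) n + (tail f *ₛ (g *ₛ h)) n)
      ≈⟨ +-assoc _ _ _ ⟨
    (f 0 * (g 0 * h (suc n)) + f 0 * (tail g *ₛ h) n) + (tail f *ₛ (g *ₛ h)) n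
      ≈⟨ +-congʳ (distribˡ _ _ _) ⟨
    f 0 * (g 0 * h (suc n) + (tail g *ₛ h) n) + (tail f *ₛ (g *ₛ h)) n ∎
    where open ≈-Reasoning

  *ₛ-congʳ : ∀ {f f′} g → f ≈ₛ f′ → (f *ₛ g) ≈ₛ (f′ *ₛ g)
  *ₛ-congʳ g e n = sumF-cong (suc n) λ i → *-congʳ {g (n ∸ toℕ i)} (e (toℕ i))

  tail-Xₛ : tail Xₛ ≈ₛ oneₛ
  tail-Xₛ zero    = refl
  tail-Xₛ (suc n) = refl

  Xₛ-*ₛ-zero : ∀ g → (Xₛ *ₛ g) 0 ≈ 0#
  Xₛ-*ₛ-zero g = trans (+-identityʳ _) (zeroˡ _)

  Xₛ-*ₛ-suc : ∀ g n → (Xₛ *ₛ g) (suc n) ≈ g n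
  Xₛ-*ₛ-suc g n = begin
    0# * g (suc n) + (tail Xₛ *ₛ g) n  ≈⟨ +-cong (zeroˡ _) (*ₛ-congʳ g tail-Xₛ n) ⟩
    0# + (oneₛ *ₛ g) n                 ≈⟨ +-identityˡ _ ⟩
    (oneₛ *ₛ g) n                      ≈⟨ *ₛ-identityˡ g n ⟩
    g n                                ∎
    where open ≈-Reasoning

  Xₛ-*ₛ-cong-≈[] : ∀ {m g h} → g ≈[ m ] h → (Xₛ *ₛ g) ≈[ suc m ] (Xₛ *ₛ h)
  Xₛ-*ₛ-cong-≈[] {g = g} {h} e = agreeBelow λ where
    zero    _         → trans (Xₛ-*ₛ-zero g) (sym (Xₛ-*ₛ-zero h))
    (suc i) (s≤s i<m) → trans (Xₛ-*ₛ-suc g i) (trans (agree e i i<m) (sym (Xₛ-*ₛ-suc h i)))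

  Xₛ²-*ₛ : ∀ y r → ((y ·ₛ (Xₛ *ₛ Xₛ)) *ₛ r) ≈ₛ (y ·ₛ (Xₛ *ₛ (Xₛ *ₛ r)))
  Xₛ²-*ₛ y r n = trans (·ₛ-*ₛ-assoc y (Xₛ *ₛ Xₛ) r n) (*-congˡ (*ₛ-assoc Xₛ Xₛ r n))

  lookup-invVec : ∀ u n (i : Fin (suc n)) → lookup (invVec u (suc n)) i ≡ invₛ u (toℕ i)
  lookup-invVec u n i with view i
  ... | ‵fromℕ = ≡.cong (invₛ u) (≡.sym (toℕ-fromℕ n))
  lookup-invVec u zero    _ | ‵inj₁ {i = ()} _
  lookup-invVec u (suc n) _ | ‵inj₁ {i = j} _ = begin
    lookup (invVec u (suc n) ∷ʳ _) (inject₁ j)  ≡⟨ lookup-∷ʳ-inject₁ (invVec u (suc n)) _ j ⟩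
    lookup (invVec u (suc n)) j                 ≡⟨ lookup-invVec u n j ⟩
    invₛ u (toℕ j)                              ≡⟨ ≡.cong (invₛ u) (toℕ-inject₁ j) ⟨
    invₛ u (toℕ (inject₁ j))                    ∎
    where open ≡.≡-Reasoning

  invₛ-suc : ∀ u n → invₛ u (suc n) ≈ - (invₛ u *ₛ tail u) n
  invₛ-suc u n = begin
    invₛ u (suc n)
      ≡⟨ lookup-∷ʳ-fromℕ (invVec u (suc n)) _ ⟩
    - sumF (suc n) (λ j → u (suc n ∸ toℕ j) * lookup (invVec u (suc n)) j)
      ≈⟨ -‿cong (sumF-cong (suc n) λ j → trans (*-comm _ _) (reflexive (≡.cong₂ _*_
           (lookup-invVec u n j) (≡.cong u (+-∸-assoc 1 (s≤s⁻¹ (toℕ<n j))))))) ⟩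
    - (invₛ u *ₛ tail u) n ∎
    where open ≈-Reasoning

  *ₛ-inverseʳ : ∀ {u} → Unitary u → (u *ₛ invₛ u) ≈ₛ oneₛ
  *ₛ-inverseʳ u₀≈1 zero = trans (+-identityʳ _) (trans (*-congʳ u₀≈1) (*-identityˡ _))
  *ₛ-inverseʳ {u} u₀≈1 (suc n) = begin
    u 0 * invₛ u (suc n) + (tail u *ₛ invₛ u) n
      ≈⟨ +-cong (*-cong u₀≈1 (invₛ-suc u n)) (*ₛ-comm (tail u) (invₛ u) n) ⟩
    1# * - (invₛ u *ₛ tail u) n + (invₛ u *ₛ tail u) n
      ≈⟨ +-congʳ (*-identityˡ _) ⟩
    - (invₛ u *ₛ tail u) n + (invₛ u *ₛ tail u) n
      ≈⟨ -‿inverseˡ _ ⟩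
    0# ∎
    where open ≈-Reasoning

  *ₛ-inverseˡ : ∀ {u} → Unitary u → (invₛ u *ₛ u) ≈ₛ oneₛ
  *ₛ-inverseˡ {u} u₀≈1 n = trans (*ₛ-comm (invₛ u) u n) (*ₛ-inverseʳ u₀≈1 n)

  invₛ-*ₛ-≈[] : ∀ {m d p q} → Unitary d → p ≈[ m ] (d *ₛ q) → (invₛ d *ₛ p) ≈[ m ] q
  invₛ-*ₛ-≈[] {m} {d} {p} {q} d₀≈1 p≈dq = begin
    invₛ d *ₛ p           ≈⟨ *ₛ-cong-≈[] (≈[]-refl {f = invₛ d}) p≈dq ⟩
    invₛ d *ₛ (d *ₛ q)    ≈⟨ ≈ₛ⇒≈[] (*ₛ-assoc (invₛ d) d q) ⟨
    (invₛ d *ₛ d) *ₛ q    ≈⟨ ≈ₛ⇒≈[] (*ₛ-congʳ q (*ₛ-inverseˡ d₀≈1)) ⟩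
    oneₛ *ₛ q             ≈⟨ ≈ₛ⇒≈[] (*ₛ-identityˡ q) ⟩
    q                     ∎
    where open ≈[]-Reasoning m

  quadraticₛ : Carrier → Carrier → Series
  quadraticₛ x y = (oneₛ +ₛ (x ·ₛ Xₛ)) +ₛ (y ·ₛ (Xₛ *ₛ Xₛ))

  quadraticₛ-coeff₁ : ∀ x y → quadraticₛ x y 1 ≈ x
  quadraticₛ-coeff₁ x y = begin
    (0# + x * 1#) + y * (Xₛ *ₛ Xₛ) 1  ≈⟨ +-cong (trans (+-identityˡ _) (*-identityʳ x)) (*-congˡ (Xₛ-*ₛ-suc Xₛ 0)) ⟩
    x + y * 0#                        ≈⟨ +-congˡ (zeroʳ y) ⟩
    x + 0#                            ≈⟨ +-identityʳ x ⟩
    x                                 ∎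
    where open ≈-Reasoning

  quadraticₛ-coeff₂ : ∀ x y → quadraticₛ x y 2 ≈ y
  quadraticₛ-coeff₂ x y = begin
    (0# + x * 0#) + y * (Xₛ *ₛ Xₛ) 2  ≈⟨ +-cong (trans (+-identityˡ _) (zeroʳ x)) (*-congˡ (Xₛ-*ₛ-suc Xₛ 1)) ⟩
    0# + y * 1#                       ≈⟨ +-identityˡ _ ⟩
    y * 1#                            ≈⟨ *-identityʳ y ⟩
    y                                 ∎
    where open ≈-Reasoning

  EuclideanStep : Series → Carrier → Carrier → Series → Series → Set ℓ
  EuclideanStep p x y q r = p ≈ₛ (((oneₛ +ₛ (x ·ₛ Xₛ)) *ₛ q) +ₛ ((y ·ₛ (Xₛ *ₛ Xₛ)) *ₛ r))

  -- r and q agree modulo w, hence y w² r and y w² q agree modulo w³.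
  EuclideanStep⇒/ₛ≈[3]quadraticₛ : ∀ {p x y q r} → EuclideanStep p x y q r → Unitary q → Unitary r →
                                   (p /ₛ q) ≈[ 3 ] quadraticₛ x y
  EuclideanStep⇒/ₛ≈[3]quadraticₛ {p} {x} {y} {q} {r} step q₀≈1 r₀≈1 = begin
    p *ₛ invₛ q     ≈⟨ ≈ₛ⇒≈[] (*ₛ-comm p (invₛ q)) ⟩
    invₛ q *ₛ p     ≈⟨ invₛ-*ₛ-≈[] q₀≈1 p≈q*quadratic ⟩
    quadraticₛ x y  ∎
    where
    open ≈[]-Reasoning 3
    r≈q : r ≈[ 1 ] q
    r≈q = agreeBelow λ { zero _ → trans r₀≈1 (sym q₀≈1) ; (suc _) (s≤s ()) }
    p≈q*quadratic : p ≈[ 3 ] (q *ₛ quadraticₛ x y)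
    p≈q*quadratic = begin
      p
        ≈⟨ ≈ₛ⇒≈[] step ⟩
      ((oneₛ +ₛ (x ·ₛ Xₛ)) *ₛ q) +ₛ ((y ·ₛ (Xₛ *ₛ Xₛ)) *ₛ r)
        ≈⟨ ≈ₛ⇒≈[] (λ n → +-congˡ (Xₛ²-*ₛ y r n)) ⟩
      ((oneₛ +ₛ (x ·ₛ Xₛ)) *ₛ q) +ₛ (y ·ₛ (Xₛ *ₛ (Xₛ *ₛ r)))
        ≈⟨ +ₛ-cong-≈[] ≈[]-refl (·ₛ-cong-≈[] refl (Xₛ-*ₛ-cong-≈[] (Xₛ-*ₛ-cong-≈[] r≈q))) ⟩
      ((oneₛ +ₛ (x ·ₛ Xₛ)) *ₛ q) +ₛ (y ·ₛ (Xₛ *ₛ (Xₛ *ₛ q)))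
        ≈⟨ ≈ₛ⇒≈[] (λ n → +-congˡ (Xₛ²-*ₛ y q n)) ⟨
      ((oneₛ +ₛ (x ·ₛ Xₛ)) *ₛ q) +ₛ ((y ·ₛ (Xₛ *ₛ Xₛ)) *ₛ q)
        ≈⟨ ≈ₛ⇒≈[] (*ₛ-distribʳ (oneₛ +ₛ (x ·ₛ Xₛ)) (y ·ₛ (Xₛ *ₛ Xₛ)) q) ⟨
      quadraticₛ x y *ₛ q
        ≈⟨ ≈ₛ⇒≈[] (*ₛ-comm (quadraticₛ x y) q) ⟩
      q *ₛ quadraticₛ x y ∎

  EuclideanStep⇒/ₛ-coeff₁ : ∀ {p x y q r} → EuclideanStep p x y q r → Unitary q → Unitary r → (p /ₛ q) 1 ≈ x
  EuclideanStep⇒/ₛ-coeff₁ {x = x} {y} step q₀≈1 r₀≈1 =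
    trans (agree (EuclideanStep⇒/ₛ≈[3]quadraticₛ step q₀≈1 r₀≈1) 1 (s≤s (s≤s z≤n))) (quadraticₛ-coeff₁ x y)

  EuclideanStep⇒/ₛ-coeff₂ : ∀ {p x y q r} → EuclideanStep p x y q r → Unitary q → Unitary r → (p /ₛ q) 2 ≈ y
  EuclideanStep⇒/ₛ-coeff₂ {x = x} {y} step q₀≈1 r₀≈1 =
    trans (agree (EuclideanStep⇒/ₛ≈[3]quadraticₛ step q₀≈1 r₀≈1) 2 (s≤s (s≤s (s≤s z≤n)))) (quadraticₛ-coeff₂ x y)

  cfDenominator : Carrier → Carrier → Series → Series
  cfDenominator x y t = oneₛ +ₛ ((x ·ₛ Xₛ) +ₛ (y ·ₛ (Xₛ *ₛ t)))

  cfDenominator-unitary : ∀ x y t → Unitary (cfDenominator x y t)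
  cfDenominator-unitary x y t = begin
    1# + (x * 0# + y * (Xₛ *ₛ t) 0)  ≈⟨ +-congˡ (+-cong (zeroʳ x) (trans (*-congˡ (Xₛ-*ₛ-zero t)) (zeroʳ y))) ⟩
    1# + (0# + 0#)                   ≈⟨ +-congˡ (+-identityʳ 0#) ⟩
    1# + 0#                          ≈⟨ +-identityʳ 1# ⟩
    1#                               ∎
    where open ≈-Reasoning

  cfDenominator-*ₛ : ∀ x y t q →
    (cfDenominator x y t *ₛ q) ≈ₛ (((oneₛ +ₛ (x ·ₛ Xₛ)) *ₛ q) +ₛ (y ·ₛ (Xₛ *ₛ (t *ₛ q))))
  cfDenominator-*ₛ x y t q n = begin
    (cfDenominator x y t *ₛ q) n
      ≈⟨ *ₛ-distribʳ oneₛ ((x ·ₛ Xₛ) +ₛ (y ·ₛ (Xₛ *ₛ t))) q n ⟩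
    (oneₛ *ₛ q) n + (((x ·ₛ Xₛ) +ₛ (y ·ₛ (Xₛ *ₛ t))) *ₛ q) n
      ≈⟨ +-congˡ (*ₛ-distribʳ (x ·ₛ Xₛ) (y ·ₛ (Xₛ *ₛ t)) q n) ⟩
    (oneₛ *ₛ q) n + (((x ·ₛ Xₛ) *ₛ q) n + ((y ·ₛ (Xₛ *ₛ t)) *ₛ q) n)
      ≈⟨ +-assoc _ _ _ ⟨
    ((oneₛ *ₛ q) n + ((x ·ₛ Xₛ) *ₛ q) n) + ((y ·ₛ (Xₛ *ₛ t)) *ₛ q) n
      ≈⟨ +-cong (sym (*ₛ-distribʳ oneₛ (x ·ₛ Xₛ) q n))
                (trans (·ₛ-*ₛ-assoc y (Xₛ *ₛ t) q n) (*-congˡ (*ₛ-assoc Xₛ t q n))) ⟩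
    ((oneₛ +ₛ (x ·ₛ Xₛ)) *ₛ q) n + y * (Xₛ *ₛ (t *ₛ q)) n ∎
    where open ≈-Reasoning

  EuclideanStep⇒≈[]cfDenominator-*ₛ : ∀ {m p x y q r a b t} → EuclideanStep p x y q r → a ≈ x → b ≈ y →
                                      (t *ₛ q) ≈[ m ] (Xₛ *ₛ r) → p ≈[ suc m ] (cfDenominator a b t *ₛ q)
  EuclideanStep⇒≈[]cfDenominator-*ₛ {m} {p} {x} {y} {q} {r} {a} {b} {t} step a≈x b≈y tq≈Xr = begin
    p
      ≈⟨ ≈ₛ⇒≈[] step ⟩
    ((oneₛ +ₛ (x ·ₛ Xₛ)) *ₛ q) +ₛ ((y ·ₛ (Xₛ *ₛ Xₛ)) *ₛ r)
      ≈⟨ ≈ₛ⇒≈[] (λ n → +-congˡ (Xₛ²-*ₛ y r n)) ⟩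
    ((oneₛ +ₛ (x ·ₛ Xₛ)) *ₛ q) +ₛ (y ·ₛ (Xₛ *ₛ (Xₛ *ₛ r)))
      ≈⟨ +ₛ-cong-≈[] (*ₛ-cong-≈[] (+ₛ-cong-≈[] (≈[]-refl {f = oneₛ}) (·ₛ-cong-≈[] (sym a≈x) (≈[]-refl {f = Xₛ}))) ≈[]-refl)
                     (·ₛ-cong-≈[] (sym b≈y) (Xₛ-*ₛ-cong-≈[] (≈[]-sym tq≈Xr))) ⟩
    ((oneₛ +ₛ (a ·ₛ Xₛ)) *ₛ q) +ₛ (b ·ₛ (Xₛ *ₛ (t *ₛ q)))
      ≈⟨ ≈ₛ⇒≈[] (cfDenominator-*ₛ a b t q) ⟨
    cfDenominator a b t *ₛ q ∎
    where open ≈[]-Reasoning (suc m)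

  cfTrunc-*ₛ≈[]Xₛ-*ₛ : ∀ (f : ℕ → Series) {α β a b : ℕ → Carrier} →
                       (∀ k → EuclideanStep (f k) (α k) (β k) (f (suc k)) (f (suc (suc k)))) →
                       (∀ k → a k ≈ α k) → (∀ k → b k ≈ β k) →
                       ∀ n k → (cfTrunc a b k n *ₛ f k) ≈[ suc n ] (Xₛ *ₛ f (suc k))
  cfTrunc-*ₛ≈[]Xₛ-*ₛ f step a≈α b≈β zero k = agreeBelow λ where
    zero    _        → trans (*ₛ-zeroˡ (f k) 0) (sym (Xₛ-*ₛ-zero (f (suc k))))
    (suc _) (s≤s ())
  cfTrunc-*ₛ≈[]Xₛ-*ₛ f {a = a} {b} step a≈α b≈β (suc n) k = begin
    (Xₛ *ₛ invₛ D) *ₛ f k  ≈⟨ ≈ₛ⇒≈[] (*ₛ-assoc Xₛ (invₛ D) (f k)) ⟩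
    Xₛ *ₛ (invₛ D *ₛ f k)  ≈⟨ Xₛ-*ₛ-cong-≈[] (invₛ-*ₛ-≈[] (cfDenominator-unitary (a k) (b k) t) fₖ≈D*fₖ₊₁) ⟩
    Xₛ *ₛ f (suc k)        ∎
    where
    open ≈[]-Reasoning (suc (suc n))
    t : Series
    t = cfTrunc a b (suc k) n
    D : Series
    D = cfDenominator (a k) (b k) t
    fₖ≈D*fₖ₊₁ : f k ≈[ suc n ] (D *ₛ f (suc k))
    fₖ≈D*fₖ₊₁ = ≈[]-weaken (EuclideanStep⇒≈[]cfDenominator-*ₛ {t = t} (step k) (a≈α k) (b≈β k)
                              (cfTrunc-*ₛ≈[]Xₛ-*ₛ f step a≈α b≈β n (suc k)))

mainTheorem3 : ∀ {c ℓ} (R : CommutativeRing c ℓ) → IsField R →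
  let open CommutativeRing R
      open Series R
  in (s : Series) → Unitary s →
     (f : ℕ → Series) (α β : ℕ → Carrier) →
     f 0 ≈ₛ oneₛ → f 1 ≈ₛ s → (∀ k → Unitary (f k)) → (∀ k → ¬ (β k ≈ 0#)) →
     (∀ k → f k ≈ₛ (((oneₛ +ₛ (α k ·ₛ Xₛ)) *ₛ f (suc k)) +ₛ ((β k ·ₛ (Xₛ *ₛ Xₛ)) *ₛ f (suc (suc k))))) →
     ∀ m → ∃ λ N → ∀ n → N ≤ n →
       cfTrunc (λ j → (f j /ₛ f (suc j)) 1) (λ j → (f j /ₛ f (suc j)) 2) 0 n m ≈ (Xₛ *ₛ s) m
mainTheorem3 R _ s _ f α β f₀≈1 f₁≈s unitary _ step m = m , λ n m≤n → agree (truncation≈[]Xₛ-*ₛs n) m (s≤s m≤n)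
  where
  open CommutativeRing R
  open Series R
  open PowerSeries R
  a b : ℕ → Carrier
  a j = (f j /ₛ f (suc j)) 1
  b j = (f j /ₛ f (suc j)) 2
  truncation≈[]Xₛ-*ₛs : ∀ n → cfTrunc a b 0 n ≈[ suc n ] (Xₛ *ₛ s)
  truncation≈[]Xₛ-*ₛs n = begin
    cfTrunc a b 0 n          ≈⟨ ≈ₛ⇒≈[] (*ₛ-identityʳ (cfTrunc a b 0 n)) ⟨
    cfTrunc a b 0 n *ₛ oneₛ  ≈⟨ *ₛ-cong-≈[] (≈[]-refl {f = cfTrunc a b 0 n}) (≈ₛ⇒≈[] f₀≈1) ⟨
    cfTrunc a b 0 n *ₛ f 0   ≈⟨ cfTrunc-*ₛ≈[]Xₛ-*ₛ f step a≈α b≈β n 0 ⟩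
    Xₛ *ₛ f 1                ≈⟨ *ₛ-cong-≈[] (≈[]-refl {f = Xₛ}) (≈ₛ⇒≈[] f₁≈s) ⟩
    Xₛ *ₛ s                  ∎
    where
    open ≈[]-Reasoning (suc n)
    a≈α : ∀ k → a k ≈ α k
    a≈α k = EuclideanStep⇒/ₛ-coeff₁ (step k) (unitary (suc k)) (unitary (suc (suc k)))
    b≈β : ∀ k → b k ≈ β k
    b≈β k = EuclideanStep⇒/ₛ-coeff₂ (step k) (unitary (suc k)) (unitary (suc (suc k)))
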